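{- Let $G=(V,E)$ be a reduced graph and $S\subseteq V$ a feedback vertex set of $G$. Let $F=V\setminus S$. Then $|N(S)\cap F|\ge \frac{|F|}{4}$.
   Context: All graphs are finite, simple and loopless. $N(x)$ is the neighbourhood and $d(x)=|N(x)|$ the degree of $x$; for $S\subseteq V$, $N(S)=\bigcup_{x\in S}N(x)\setminus S$. A feedback vertex set of $G$ is a set $S\subseteq V$ such that the subgraph induced by $V\setminus S$ is a forest. A graph $G$ is called reduced if it has no vertex of degree at most $1$, and there is no edge $uv$ with $d(u)=d(v)=2$ and $N(u)\cap N(v)=\emptyset$. -}

module Defs where

open import Data.Nat using (ℕ; _≤_; _*_)
open import Data.Bool using (Bool; true; false)
open import Data.Fin using (Fin)
open import Data.Fin.Subset using (Subset; _∈_; _∉_; ∁; _∩_; _─_; ⋃; ∣_∣)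
open import Data.Fin.Subset.Properties using (_∈?_)
open import Data.Vec using (tabulate)
import Data.List as List
open import Data.List using (List; _∷_; []; length; last)
open import Data.List.Relation.Unary.All using (All)
open import Data.List.Relation.Unary.Linked using (Linked)
open import Data.List.Relation.Unary.Unique.Propositional using (Unique)
open import Data.Maybe using (just)
open import Data.Product using (Σ; ∃; _×_)
open import Relation.Nullary using (¬_)
open import Relation.Binary.PropositionalEquality using (_≡_)

record Graph (n : ℕ) : Set where
  field
    adj     : Fin n → Fin n → Bool
    adj-sym : ∀ x y → adj x y ≡ adj y x
    loopless : ∀ x → adj x x ≡ false

module _ {n : ℕ} (G : Graph n) where
  open Graph G

  Adj : Fin n → Fin n → Set
  Adj x y = adj x y ≡ true

  N : Fin n → Subset n
  N x = tabulate (adj x)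

  deg : Fin n → ℕ
  deg x = ∣ N x ∣

  NSet : Subset n → Subset n
  NSet S = ⋃ (List.map N (List.filter (_∈? S) (List.allFin n))) ─ S

  record CycleIn (X : Subset n) : Set where
    field
      verts    : List (Fin n)
      long     : 3 ≤ length verts
      distinct : Unique verts
      inside   : All (_∈ X) verts
      path     : Linked Adj verts
      closing  : ∀ {u v} → List.head verts ≡ just u → last verts ≡ just v → Adj v u

  IsForest : Subset n → Set
  IsForest X = ¬ CycleIn X

  IsFVS : Subset n → Set
  IsFVS S = IsForest (∁ S)

  IsReduced : Set
  IsReduced =
    (∀ x → ¬ (deg x ≤ 1)) ×
    (∀ u v → Adj u v → deg u ≡ 2 → deg v ≡ 2 → ∃ λ w → w ∈ N u × w ∈ N v)

module Submission where

-- Let F = V ∖ S and A = N(S) ∩ F. A vertex of F ∖ A (an inner vertex) has all its neighbours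
-- in F, so reducedness makes its degree d in the forest G[F] at least 2; split the inner
-- vertices into those with d = 2 (inner₂) and d ≥ 3 (inner₃), and call A ∪ inner₃ the hubs.
-- Two adjacent inner₂ vertices would have a common neighbour (G is reduced), i.e. a triangle
-- in G[F]; hence both neighbours of an inner₂ vertex are hubs. Writing s for the total
-- d-degree of the hubs and I for the number of isolated vertices of G[F]:
--   * G[F] is a forest, so  Σ_F d + 2I ≤ 2|F|,  i.e.  s + 2I ≤ 2(|A| + |inner₃|);
--   * counting hub–inner₂ edges,  2|inner₂| ≤ s;
--   * inner₃ vertices have d ≥ 3 and non-isolated ones in A have d ≥ 1,  so  3|inner₃| + |A| ≤ s + I.
-- Thus |inner₃| ≤ |A| and |inner₂| ≤ |A| + |inner₃|, so |F| = |A| + |inner₃| + |inner₂| ≤ 4|A|.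

open import Data.Bool using (Bool; true; false; _∧_; not; _≟_)
open import Data.Bool.Properties using (∧-conicalˡ; ∧-conicalʳ; ∧-identityʳ; not-injective)
open import Data.Empty using (⊥-elim)
open import Data.Fin using (Fin; zero; suc; punchIn)
import Data.Fin.Properties as Fin
open import Data.Fin.Subset using (Subset; ∁; _∩_; ⋃; ∣_∣; _∈_; _⊆_)
open import Data.Fin.Subset.Properties using (_∈?_; x∈p∪q⁺; x∈p∩q⁺; x∈p∧x∉q⇒x∈p─q; x∈∁p⇒x∉p)
open import Data.List as List using (List; _∷_; []; length; last)
open import Data.List.Membership.Propositional using () renaming (_∈_ to _∈ₗ_)
open import Data.List.Membership.Propositional.Properties using (∈-map⁺; ∈-filter⁺; ∈-allFin)
open import Data.List.Relation.Unary.All as All using (All; _∷_; [])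
open import Data.List.Relation.Unary.All.Properties using (¬Any⇒All¬)
open import Data.List.Relation.Unary.AllPairs using ([]; _∷_)
open import Data.List.Relation.Unary.Any using (here; there; any?)
open import Data.List.Relation.Unary.Linked using (Linked; [-]; _∷_)
open import Data.List.Relation.Unary.Unique.Propositional using (Unique)
open import Data.Maybe using (just)
open import Data.Maybe.Properties using (just-injective)
open import Data.Nat using (ℕ; zero; suc; _+_; _*_; _≤_; _<_; z≤n; s≤s; s≤s⁻¹; _≤?_; _≤ᵇ_)
open import Data.Nat.Properties
  using ( ≤-refl; ≤-trans; ≤-reflexive; <-≤-trans; ≰⇒>; m≤m+n; m≤n+m; 1+n≰n
        ; +-identityʳ; *-identityˡ; *-identityʳ; *-suc; *-distribˡ-+
        ; +-mono-≤; +-monoˡ-≤; +-monoʳ-≤; +-mono-<-≤; +-mono-≤-<; *-monoʳ-≤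
        ; +-cancelʳ-≤; *-cancelˡ-≤; module ≤-Reasoning
        ; +-commutativeSemigroup; *-commutativeSemigroup; +-*-semiring )
open import Algebra.Properties.CommutativeSemigroup +-commutativeSemigroup using (xy∙z≈xz∙y)
open import Algebra.Properties.CommutativeSemigroup *-commutativeSemigroup using (x∙yz≈z∙yx)
open import Algebra.Properties.Semiring.Sum +-*-semiring
  using (sum; sum-remove; sum-cong-≗; ∑-distrib-+; ∑-comm; *-distribˡ-sum)
open import Data.Nat.Tactic.RingSolver using (solve-∀)
open import Data.Product using (∃; _×_; _,_; proj₁; proj₂)
open import Data.Sum using (inj₁; inj₂)
open import Data.Vec using (lookup; tabulate; _∷_; [])
open import Data.Vec.Properties
  using (lookup∘tabulate; tabulate∘lookup; lookup-map; lookup-zipWith; lookup⇒[]=; []=⇒lookup)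
open import Function using (_∘_; case_of_)
open import Level using (0ℓ)
open import Relation.Binary using (Rel)
open import Relation.Binary.PropositionalEquality
open import Relation.Nullary using (¬_; Dec; does; yes; no)
open import Relation.Nullary.Decidable using (_×-dec_; ¬?; decidable-stable; dec-true; dec-false)
open import Relation.Unary using (Pred)

open import Defs

𝟙 : Bool → ℕ
𝟙 true  = 1
𝟙 false = 0

count : ∀ {m} → (Fin m → Bool) → ℕ
count P = sum (𝟙 ∘ P)

δ : ∀ {m} → Fin m → Fin m → Bool
δ v w = does (w Fin.≟ v)

sum-mono-≤ : ∀ {m} {f g : Fin m → ℕ} → (∀ i → f i ≤ g i) → sum f ≤ sum g
sum-mono-≤ {zero}  f≤g = z≤n
sum-mono-≤ {suc m} f≤g = +-mono-≤ (f≤g zero) (sum-mono-≤ (f≤g ∘ suc))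

sum-mono-< : ∀ {m} {f g : Fin m → ℕ} (v : Fin m) → (∀ i → f i ≤ g i) → f v < g v → sum f < sum g
sum-mono-< zero    f≤g fv<gv = +-mono-<-≤ fv<gv (sum-mono-≤ (f≤g ∘ suc))
sum-mono-< (suc v) f≤g fv<gv = +-mono-≤-< (f≤g zero) (sum-mono-< v (f≤g ∘ suc) fv<gv)

sum-zero : ∀ {m} {f : Fin m → ℕ} → (∀ i → f i ≡ 0) → sum f ≡ 0
sum-zero {zero}  f≡0 = refl
sum-zero {suc m} f≡0 rewrite f≡0 zero = sum-zero (f≡0 ∘ suc)

sum-δ : ∀ {m} (v : Fin m) (f : Fin m → ℕ) → sum (λ w → 𝟙 (δ v w) * f w) ≡ f v
sum-δ {suc m} v f = begin
  sum (λ w → 𝟙 (δ v w) * f w)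
    ≡⟨ sum-remove {i = v} (λ w → 𝟙 (δ v w) * f w) ⟩
  𝟙 (δ v v) * f v + sum (λ j → 𝟙 (δ v (punchIn v j)) * f (punchIn v j))
    ≡⟨ cong₂ _+_ (cong (λ b → 𝟙 b * f v) (dec-true (v Fin.≟ v) refl))
                 (sum-zero (λ j → cong (λ b → 𝟙 b * f (punchIn v j))
                                       (dec-false (punchIn v j Fin.≟ v) (Fin.punchInᵢ≢i v j)))) ⟩
  f v + 0 + 0
    ≡⟨ trans (+-identityʳ _) (+-identityʳ _) ⟩
  f v ∎
  where open ≡-Reasoning

count-δ : ∀ {m} (v : Fin m) → count (δ v) ≡ 1
count-δ v = trans (sum-cong-≗ (λ w → sym (*-identityʳ (𝟙 (δ v w))))) (sum-δ v (λ _ → 1))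

count-lookup : ∀ {m} (p : Subset m) → ∣ p ∣ ≡ count (lookup p)
count-lookup []          = refl
count-lookup (true ∷ p)  = cong suc (count-lookup p)
count-lookup (false ∷ p) = count-lookup p

count≥2⇒∃≢ : ∀ {m} (P : Fin m → Bool) → 2 ≤ count P → (u : Fin m) → ∃ λ w → P w ≡ true × w ≢ u
count≥2⇒∃≢ P 2≤#P u with Fin.any? (λ w → (P w ≟ true) ×-dec ¬? (w Fin.≟ u))
... | yes found = found
... | no none   = ⊥-elim (1+n≰n (≤-trans 2≤#P (≤-trans (sum-mono-≤ P≤δ) (≤-reflexive (count-δ u)))))
  where
  P≤δ : ∀ w → 𝟙 (P w) ≤ 𝟙 (δ u w)
  P≤δ w with P w in Pw | w Fin.≟ u
  ... | false | _      = z≤n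
  ... | true  | yes _  = ≤-refl
  ... | true  | no w≢u = ⊥-elim (none (w , Pw , w≢u))

∈-tabulate⁺ : ∀ {m} {X : Fin m → Bool} {w} → X w ≡ true → w ∈ tabulate X
∈-tabulate⁺ {X = X} {w} Xw = lookup⇒[]= w (tabulate X) (trans (lookup∘tabulate X w) Xw)

∈⋃⁺ : ∀ {m} {x : Fin m} {p} (ps : List (Subset m)) → p ∈ₗ ps → x ∈ p → x ∈ ⋃ ps
∈⋃⁺ (q ∷ ps) (here refl)  x∈p = x∈p∪q⁺ (inj₁ x∈p)
∈⋃⁺ (q ∷ ps) (there p∈ps) x∈p = x∈p∪q⁺ (inj₂ (∈⋃⁺ ps p∈ps x∈p))

infix 4 _∈ₗ?_
_∈ₗ?_ : ∀ {m} (w : Fin m) xs → Dec (w ∈ₗ xs)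
w ∈ₗ? xs = any? (w Fin.≟_) xs

unvisited : ∀ {m} → List (Fin m) → ℕ
unvisited path = count (λ w → not (does (w ∈ₗ? path)))

unvisited-∷ : ∀ {m} {w : Fin m} {path} → ¬ w ∈ₗ path → unvisited (w ∷ path) < unvisited path
unvisited-∷ {w = w} {path} w∉path = sum-mono-< w fewer newly
  where
  fewer : ∀ u → 𝟙 (not (does (u ∈ₗ? w ∷ path))) ≤ 𝟙 (not (does (u ∈ₗ? path)))
  fewer u with u Fin.≟ w | u ∈ₗ? path
  ... | yes _ | _     = z≤n
  ... | no _  | yes _ = z≤n
  ... | no _  | no _  = ≤-refl
  newly : 𝟙 (not (does (w ∈ₗ? w ∷ path))) < 𝟙 (not (does (w ∈ₗ? path)))
  newly with w Fin.≟ w | w ∈ₗ? path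
  ... | _      | yes w∈path = ⊥-elim (w∉path w∈path)
  ... | yes _  | no _       = s≤s z≤n
  ... | no w≢w | no _       = ⊥-elim (w≢w refl)

module _ {n : ℕ} {w : Fin n} where

  prefixTo : ∀ xs → w ∈ₗ xs → List (Fin n)
  prefixTo (x ∷ xs) (here _)  = w ∷ []
  prefixTo (x ∷ xs) (there p) = x ∷ prefixTo xs p

  prefixTo-All : ∀ {P : Pred (Fin n) 0ℓ} xs (p : w ∈ₗ xs) → All P xs → All P (prefixTo xs p)
  prefixTo-All (x ∷ xs) (here refl) (Px ∷ _)   = Px ∷ []
  prefixTo-All (x ∷ xs) (there p)   (Px ∷ Pxs) = Px ∷ prefixTo-All xs p Pxs

  prefixTo-Unique : ∀ xs (p : w ∈ₗ xs) → Unique xs → Unique (prefixTo xs p)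
  prefixTo-Unique (x ∷ xs) (here refl) _            = [] ∷ []
  prefixTo-Unique (x ∷ xs) (there p)   (x∉xs ∷ !xs) = prefixTo-All xs p x∉xs ∷ prefixTo-Unique xs p !xs

  prefixTo-Linked : ∀ {R : Rel (Fin n) 0ℓ} x xs (p : w ∈ₗ x ∷ xs) →
                    Linked R (x ∷ xs) → Linked R (prefixTo (x ∷ xs) p)
  prefixTo-Linked x xs       (here refl)         _           = [-]
  prefixTo-Linked x (y ∷ xs) (there (here refl)) (Rxy ∷ _)   = Rxy ∷ [-]
  prefixTo-Linked x (y ∷ xs) (there (there p))   (Rxy ∷ Rys) = Rxy ∷ prefixTo-Linked y xs (there p) Rys

  prefixTo-last : ∀ xs (p : w ∈ₗ xs) → last (prefixTo xs p) ≡ just w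
  prefixTo-last (x ∷ xs)     (here refl)         = refl
  prefixTo-last (x ∷ y ∷ xs) (there (here refl)) = refl
  prefixTo-last (x ∷ y ∷ xs) (there (there p))   = prefixTo-last (y ∷ xs) (there p)

  prefixTo-length : ∀ xs (p : w ∈ₗ xs) → 1 ≤ length (prefixTo xs p)
  prefixTo-length (x ∷ xs) (here refl) = s≤s z≤n
  prefixTo-length (x ∷ xs) (there p)   = s≤s z≤n

-- Summed over a vertex set X, this is twice the number of edges of G[X] plus twice the
-- number of its isolated vertices; for a forest that is at most 2|X|.
degWeight : ℕ → ℕ
degWeight zero    = 2
degWeight (suc d) = suc d

degWeight-+ : ∀ a b → degWeight (a + b) ≤ a + degWeight b
degWeight-+ zero    b       = ≤-refl
degWeight-+ (suc a) zero    = s≤s (+-monoʳ-≤ a z≤n)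
degWeight-+ (suc a) (suc b) = ≤-refl

leaf-degWeight : ∀ {d′ d} → d′ ≤ d → d ≤ 1 → d′ + degWeight d ≤ 2
leaf-degWeight z≤n       z≤n       = ≤-refl
leaf-degWeight z≤n       (s≤s z≤n) = s≤s z≤n
leaf-degWeight (s≤s z≤n) (s≤s z≤n) = ≤-refl

module _ {n : ℕ} (G : Graph n) where
  open Graph G

  adj⇒≢ : ∀ {x y} → Adj G x y → x ≢ y
  adj⇒≢ {x} xy refl = case trans (sym xy) (loopless x) of λ ()

  deg≡count : ∀ v → deg G v ≡ count (adj v)
  deg≡count v = trans (count-lookup (tabulate (adj v))) (sum-cong-≗ (cong 𝟙 ∘ lookup∘tabulate (adj v)))

  CycleIn-mono : ∀ {X Y} → X ⊆ Y → CycleIn G X → CycleIn G Y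
  CycleIn-mono X⊆Y cycle = record
    { verts = verts ; long = long ; distinct = distinct
    ; inside = All.map X⊆Y inside ; path = path ; closing = closing }
    where open CycleIn cycle

  closeCycle : ∀ {X v r rest w} → Unique (v ∷ r ∷ rest) → All (_∈ X) (v ∷ r ∷ rest) →
               Linked (Adj G) (v ∷ r ∷ rest) → w ∈ₗ rest → Adj G v w → CycleIn G X
  closeCycle {v = v} {r} {rest} {w} distinct inside path w∈rest vw = record
    { verts    = prefixTo (v ∷ r ∷ rest) w∈path
    ; long     = s≤s (s≤s (prefixTo-length rest w∈rest))
    ; distinct = prefixTo-Unique (v ∷ r ∷ rest) w∈path distinct
    ; inside   = prefixTo-All (v ∷ r ∷ rest) w∈path inside
    ; path     = prefixTo-Linked v (r ∷ rest) w∈path path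
    ; closing  = closing
    }
    where
    w∈path : w ∈ₗ v ∷ r ∷ rest
    w∈path = there (there w∈rest)
    closing : ∀ {x y} → List.head (prefixTo (v ∷ r ∷ rest) w∈path) ≡ just x →
              last (prefixTo (v ∷ r ∷ rest) w∈path) ≡ just y → Adj G y x
    closing refl last≡y with just-injective (trans (sym last≡y) (prefixTo-last (v ∷ r ∷ rest) w∈path))
    ... | refl = trans (adj-sym w v) vw

  degIn : (Fin n → Bool) → Fin n → ℕ
  degIn X v = count (λ w → adj v w ∧ X w)

  module _ (X : Fin n → Bool) (minDegree : ∀ v → X v ≡ true → 2 ≤ degIn X v) where

    private
      InX : Pred (Fin n) 0ℓ
      InX v = X v ≡ true

      previous : Fin n → List (Fin n) → Fin n
      previous v []      = v
      previous v (r ∷ _) = r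

    closeAtVisited : ∀ {v rest w} → Unique (v ∷ rest) → All InX (v ∷ rest) → Linked (Adj G) (v ∷ rest) →
                     Adj G v w → w ≢ previous v rest → w ∈ₗ v ∷ rest → CycleIn G (tabulate X)
    closeAtVisited _ _ _ ww _ (here refl) = ⊥-elim (adj⇒≢ ww refl)
    closeAtVisited {rest = []}    _ _ _ _ _ (there ())
    closeAtVisited {rest = _ ∷ _} _ _ _ _ w≢r (there (here w≡r)) = ⊥-elim (w≢r w≡r)
    closeAtVisited {rest = _ ∷ _} distinct inside path vw _ (there (there w∈rest)) =
      closeCycle distinct (All.map ∈-tabulate⁺ inside) path w∈rest vw

    -- Grow a path at its head v. If v has no neighbour in X off the path, its second
    -- neighbour in X (other than its predecessor) is further back on the path, closing a cycle.
    extendPath : ∀ k v rest → unvisited (v ∷ rest) < k → Unique (v ∷ rest) → All InX (v ∷ rest) →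
                 Linked (Adj G) (v ∷ rest) → CycleIn G (tabulate X)
    extendPath (suc k) v rest bound distinct inside path
      with Fin.any? (λ w → ((adj v w ∧ X w) ≟ true) ×-dec ¬? (w ∈ₗ? v ∷ rest))
    ... | yes (w , vw∧Xw , w∉path) =
      extendPath k w (v ∷ rest) (<-≤-trans (unvisited-∷ w∉path) (s≤s⁻¹ bound))
        (¬Any⇒All¬ (v ∷ rest) w∉path ∷ distinct)
        (∧-conicalʳ _ _ vw∧Xw ∷ inside)
        (trans (adj-sym w v) (∧-conicalˡ _ _ vw∧Xw) ∷ path)
    ... | no noNewNeighbour =
      let w , vw∧Xw , w≢prev = count≥2⇒∃≢ _ (minDegree v (All.head inside)) (previous v rest)
          w∈path = decidable-stable (w ∈ₗ? v ∷ rest) (λ w∉path → noNewNeighbour (w , vw∧Xw , w∉path))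
      in closeAtVisited distinct inside path (∧-conicalˡ _ _ vw∧Xw) w≢prev w∈path

    minDegree≥2⇒cycle : ∀ {v} → X v ≡ true → CycleIn G (tabulate X)
    minDegree≥2⇒cycle {v} Xv = extendPath (suc (unvisited (v ∷ []))) v [] ≤-refl ([] ∷ []) (Xv ∷ []) [-]

  acyclic⇒leaf : ∀ {X v} → IsForest G (tabulate X) → X v ≡ true → ∃ λ u → X u ≡ true × degIn X u ≤ 1
  acyclic⇒leaf {X} acyclic Xv with Fin.any? (λ u → (X u ≟ true) ×-dec (degIn X u ≤? 1))
  ... | yes leaf  = leaf
  ... | no noLeaf = ⊥-elim (acyclic (minDegree≥2⇒cycle X (λ u Xu → ≰⇒> (λ du≤1 → noLeaf (u , Xu , du≤1))) Xv))

  delete : (Fin n → Bool) → Fin n → Fin n → Bool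
  delete X v w = X w ∧ not (δ v w)

  delete-acyclic : ∀ {X} v → IsForest G (tabulate X) → IsForest G (tabulate (delete X v))
  delete-acyclic {X} v acyclic = acyclic ∘ CycleIn-mono delete⊆
    where
    delete⊆ : tabulate (delete X v) ⊆ tabulate X
    delete⊆ {w} w∈X′ =
      ∈-tabulate⁺ (∧-conicalˡ _ _ (trans (sym (lookup∘tabulate (delete X v) w)) ([]=⇒lookup w∈X′)))

  count-delete : ∀ {X v} → X v ≡ true → (P : Fin n → Bool) →
                 count (λ w → P w ∧ X w) ≡ 𝟙 (P v) + count (λ w → P w ∧ delete X v w)
  count-delete {X} {v} Xv P = begin
    count (λ w → P w ∧ X w)
      ≡⟨ sum-cong-≗ split ⟩
    sum (λ w → 𝟙 (δ v w) * 𝟙 (P w) + 𝟙 (P w ∧ delete X v w))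
      ≡⟨ ∑-distrib-+ (λ w → 𝟙 (δ v w) * 𝟙 (P w)) (λ w → 𝟙 (P w ∧ delete X v w)) ⟩
    sum (λ w → 𝟙 (δ v w) * 𝟙 (P w)) + count (λ w → P w ∧ delete X v w)
      ≡⟨ cong (_+ count (λ w → P w ∧ delete X v w)) (sum-δ v (𝟙 ∘ P)) ⟩
    𝟙 (P v) + count (λ w → P w ∧ delete X v w) ∎
    where
    open ≡-Reasoning
    split : ∀ w → 𝟙 (P w ∧ X w) ≡ 𝟙 (δ v w) * 𝟙 (P w) + 𝟙 (P w ∧ delete X v w)
    split w with w Fin.≟ v
    ... | no _     rewrite ∧-identityʳ (X w) = refl
    ... | yes refl rewrite Xv with P w
    ...   | true  = refl
    ...   | false = refl

  weight : (Fin n → Bool) → ℕ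
  weight X = sum (λ w → 𝟙 (X w) * degWeight (degIn X w))

  weight-delete : ∀ {X v} → X v ≡ true →
                  weight X ≤ (degIn (delete X v) v + degWeight (degIn X v)) + weight (delete X v)
  weight-delete {X} {v} Xv = begin
    weight X
      ≤⟨ sum-mono-≤ termwise ⟩
    sum (λ w → (𝟙 (adj v w ∧ X′ w) + 𝟙 (δ v w) * degWeight (degIn X v)) + term X′ w)
      ≡⟨ ∑-distrib-+ (λ w → 𝟙 (adj v w ∧ X′ w) + 𝟙 (δ v w) * degWeight (degIn X v)) (term X′) ⟩
    sum (λ w → 𝟙 (adj v w ∧ X′ w) + 𝟙 (δ v w) * degWeight (degIn X v)) + weight X′
      ≡⟨ cong (_+ weight X′)
              (trans (∑-distrib-+ (λ w → 𝟙 (adj v w ∧ X′ w)) (λ w → 𝟙 (δ v w) * degWeight (degIn X v)))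
                     (cong (degIn X′ v +_) (sum-δ v (λ _ → degWeight (degIn X v))))) ⟩
    (degIn X′ v + degWeight (degIn X v)) + weight X′ ∎
    where
    open ≤-Reasoning
    X′ : Fin n → Bool
    X′ = delete X v
    term : (Fin n → Bool) → Fin n → ℕ
    term Y w = 𝟙 (Y w) * degWeight (degIn Y w)
    termwise : ∀ w → term X w ≤ (𝟙 (adj v w ∧ X′ w) + 𝟙 (δ v w) * degWeight (degIn X v)) + term X′ w
    termwise w with w Fin.≟ v
    ... | yes refl rewrite Xv | loopless w = m≤m+n _ _
    ... | no _ with X w
    ...   | false = z≤n
    ...   | true  = begin
      1 * degWeight (degIn X w)
        ≡⟨ trans (*-identityˡ _) (cong degWeight (count-delete Xv (adj w))) ⟩
      degWeight (𝟙 (adj w v) + degIn X′ w)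
        ≤⟨ degWeight-+ (𝟙 (adj w v)) (degIn X′ w) ⟩
      𝟙 (adj w v) + degWeight (degIn X′ w)
        ≡⟨ cong₂ _+_ (trans (cong 𝟙 (adj-sym w v)) (𝟙≡𝟙[∧true]+0 (adj v w))) (sym (*-identityˡ _)) ⟩
      (𝟙 (adj v w ∧ true) + 0) + 1 * degWeight (degIn X′ w) ∎
      where
      𝟙≡𝟙[∧true]+0 : ∀ b → 𝟙 b ≡ 𝟙 (b ∧ true) + 0
      𝟙≡𝟙[∧true]+0 true  = refl
      𝟙≡𝟙[∧true]+0 false = refl

  acyclic⇒weight≤ : ∀ {X} → IsForest G (tabulate X) → weight X ≤ 2 * count X
  acyclic⇒weight≤ {X} = bound (suc (count X)) ≤-refl
    where
    bound : ∀ k {X} → count X < k → IsForest G (tabulate X) → weight X ≤ 2 * count X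
    bound (suc k) {X} #X<k acyclic with Fin.any? (λ v → X v ≟ true)
    ... | no empty = ≤-trans (≤-reflexive (sum-zero absent)) z≤n
      where
      absent : ∀ w → 𝟙 (X w) * degWeight (degIn X w) ≡ 0
      absent w with X w in Xw
      ... | true  = ⊥-elim (empty (w , Xw))
      ... | false = refl
    ... | yes (_ , Xu) with acyclic⇒leaf acyclic Xu
    ... | v , Xv , dv≤1 = begin
      weight X                                          ≤⟨ weight-delete Xv ⟩
      (degIn X′ v + degWeight (degIn X v)) + weight X′  ≤⟨ +-mono-≤ (leaf-degWeight degIn-shrinks dv≤1) ih ⟩
      2 + 2 * count X′                                  ≡⟨ sym (*-suc 2 (count X′)) ⟩
      2 * suc (count X′)                                ≡⟨ cong (2 *_) (sym #X) ⟩
      2 * count X                                       ∎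
      where
      open ≤-Reasoning
      X′ : Fin n → Bool
      X′ = delete X v
      #X : count X ≡ suc (count X′)
      #X = count-delete Xv (λ _ → true)
      degIn-shrinks : degIn X′ v ≤ degIn X v
      degIn-shrinks = ≤-trans (m≤n+m _ _) (≤-reflexive (sym (count-delete Xv (adj v))))
      ih : weight X′ ≤ 2 * count X′
      ih = bound k (s≤s⁻¹ (subst (_< suc k) #X #X<k)) (delete-acyclic v acyclic)

four-attachments-bound : ∀ a u₃ u₂ i s → s + 2 * i ≤ 2 * (a + u₃) → 3 * u₃ + a ≤ s + i → 2 * u₂ ≤ s →
                         a + u₃ + u₂ ≤ 4 * a
four-attachments-bound a u₃ u₂ i s forest degrees pairs = begin
  a + u₃ + u₂        ≤⟨ +-monoʳ-≤ (a + u₃) u₂≤a+u₃ ⟩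
  a + u₃ + (a + u₃)  ≤⟨ +-mono-≤ (+-monoʳ-≤ a u₃≤a) (+-monoʳ-≤ a u₃≤a) ⟩
  a + a + (a + a)    ≡⟨ m+m+[m+m]≡4m a ⟩
  4 * a              ∎
  where
  open ≤-Reasoning
  m+n+[o+2m]≡3m+o+n : ∀ m n o → m + n + (o + 2 * m) ≡ 3 * m + o + n
  m+n+[o+2m]≡3m+o+n = solve-∀
  m+n+n≡m+2n : ∀ m n → m + n + n ≡ m + 2 * n
  m+n+n≡m+2n = solve-∀
  2[m+n]≡m+[m+2n] : ∀ m n → 2 * (m + n) ≡ m + (m + 2 * n)
  2[m+n]≡m+[m+2n] = solve-∀
  m+m+[m+m]≡4m : ∀ m → m + m + (m + m) ≡ 4 * m
  m+m+[m+m]≡4m = solve-∀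
  u₃≤a : u₃ ≤ a
  u₃≤a = ≤-trans (m≤m+n u₃ i) (+-cancelʳ-≤ (a + 2 * u₃) _ _ (begin
    u₃ + i + (a + 2 * u₃) ≡⟨ m+n+[o+2m]≡3m+o+n u₃ i a ⟩
    3 * u₃ + a + i        ≤⟨ +-monoˡ-≤ i degrees ⟩
    s + i + i             ≡⟨ m+n+n≡m+2n s i ⟩
    s + 2 * i             ≤⟨ forest ⟩
    2 * (a + u₃)          ≡⟨ 2[m+n]≡m+[m+2n] a u₃ ⟩
    a + (a + 2 * u₃)      ∎))
  u₂≤a+u₃ : u₂ ≤ a + u₃
  u₂≤a+u₃ = *-cancelˡ-≤ 2 (≤-trans pairs (≤-trans (m≤m+n s (2 * i)) forest))

module Counting {n : ℕ} (G : Graph n) (S : Subset n) (reduced : IsReduced G) (fvs : IsFVS G S) where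
  open Graph G

  F A : Fin n → Bool
  F = lookup (∁ S)
  A = lookup (NSet G S ∩ ∁ S)

  d : Fin n → ℕ
  d = degIn G F

  F-acyclic : IsForest G (tabulate F)
  F-acyclic rewrite tabulate∘lookup (∁ S) = fvs

  A⇒F : ∀ {v} → A v ≡ true → F v ≡ true
  A⇒F {v} Av = ∧-conicalʳ _ _ (trans (sym (lookup-zipWith _∧_ v (NSet G S) (∁ S))) Av)

  S-neighbour⇒A : ∀ {x w} → lookup S x ≡ true → Adj G x w → F w ≡ true → A w ≡ true
  S-neighbour⇒A {x} {w} Sx xw Fw = []=⇒lookup (x∈p∩q⁺ (x∈p∧x∉q⇒x∈p─q w∈⋃N (x∈∁p⇒x∉p w∈F) , w∈F))
    where
    w∈F : w ∈ ∁ S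
    w∈F = lookup⇒[]= w (∁ S) Fw
    w∈⋃N : w ∈ ⋃ (List.map (N G) (List.filter (_∈? S) (List.allFin n)))
    w∈⋃N = ∈⋃⁺ _ (∈-map⁺ (N G) (∈-filter⁺ (_∈? S) (∈-allFin x) (lookup⇒[]= x S Sx)))
                 (lookup⇒[]= w (tabulate (adj x)) (trans (lookup∘tabulate (adj x) w) xw))

  inner-neighbour⇒F : ∀ {v w} → F v ≡ true → A v ≡ false → Adj G v w → F w ≡ true
  inner-neighbour⇒F {v} {w} Fv Av vw with F w in Fw
  ... | true  = refl
  ... | false = case trans (sym (S-neighbour⇒A Sw (trans (adj-sym w v) vw) Fv)) Av of λ ()
    where
    Sw : lookup S w ≡ true
    Sw = not-injective (trans (sym (lookup-map w not S)) Fw)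

  inner-d≡deg : ∀ {v} → F v ≡ true → A v ≡ false → d v ≡ deg G v
  inner-d≡deg {v} Fv Av = trans (sum-cong-≗ neighbour-in-F) (sym (deg≡count G v))
    where
    neighbour-in-F : ∀ w → 𝟙 (adj v w ∧ F w) ≡ 𝟙 (adj v w)
    neighbour-in-F w with adj v w in vw
    ... | true  rewrite inner-neighbour⇒F Fv Av vw = refl
    ... | false = refl

  inner-d≥2 : ∀ {v} → F v ≡ true → A v ≡ false → 2 ≤ d v
  inner-d≥2 {v} Fv Av = ≤-trans (≰⇒> (proj₁ reduced v)) (≤-reflexive (sym (inner-d≡deg Fv Av)))

  -- Reducedness gives adjacent inner vertices of degree 2 a common neighbour, hence a triangle in G[F].
  inner₂-nonadjacent : ∀ {v w} → F v ≡ true → A v ≡ false → d v ≡ 2 →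
                                F w ≡ true → A w ≡ false → d w ≡ 2 → ¬ Adj G v w
  inner₂-nonadjacent {v} {w} Fv Av dv Fw Aw dw vw =
    let x , x∈Nv , x∈Nw = proj₂ reduced v w vw (trans (sym (inner-d≡deg Fv Av)) dv)
                                              (trans (sym (inner-d≡deg Fw Aw)) dw)
        vx = trans (sym (lookup∘tabulate (adj v) x)) ([]=⇒lookup x∈Nv)
        wx = trans (sym (lookup∘tabulate (adj w) x)) ([]=⇒lookup x∈Nw)
    in F-acyclic record
      { verts    = v ∷ w ∷ x ∷ []
      ; long     = s≤s (s≤s (s≤s z≤n))
      ; distinct = (adj⇒≢ G vw ∷ adj⇒≢ G vx ∷ []) ∷ (adj⇒≢ G wx ∷ []) ∷ [] ∷ []
      ; inside   = All.map ∈-tabulate⁺ (Fv ∷ Fw ∷ inner-neighbour⇒F Fv Av vx ∷ [])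
      ; path     = vw ∷ wx ∷ [-]
      ; closing  = λ { refl refl → trans (adj-sym x v) vx }
      }

  isInner₂ isInner₃ isIsolated : Fin n → Bool
  isInner₂ v   = F v ∧ not (A v) ∧ not (3 ≤ᵇ d v)
  isInner₃ v   = F v ∧ not (A v) ∧ (3 ≤ᵇ d v)
  isIsolated v = F v ∧ (d v ≤ᵇ 0)

  hub : Fin n → ℕ
  hub v = 𝟙 (A v) + 𝟙 (isInner₃ v)

  data Kind (v : Fin n) : Set where
    outside  : F v ≡ false → A v ≡ false → Kind v
    attached : F v ≡ true → A v ≡ true → Kind v
    inner₂   : F v ≡ true → A v ≡ false → d v ≡ 2 → Kind v
    inner₃   : ∀ {k} → F v ≡ true → A v ≡ false → d v ≡ 3 + k → Kind v

  kind : ∀ v → Kind v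
  kind v with F v in Fv | A v in Av
  ... | false | true  = case trans (sym (A⇒F Av)) Fv of λ ()
  ... | false | false = outside Fv Av
  ... | true  | true  = attached Fv Av
  ... | true  | false with d v in dv | inner-d≥2 Fv Av
  ...   | zero              | ()
  ...   | suc zero          | s≤s ()
  ...   | suc (suc zero)    | _ = inner₂ Fv Av dv
  ...   | suc (suc (suc _)) | _ = inner₃ Fv Av dv

  F-partition : ∀ v → 𝟙 (F v) ≡ hub v + 𝟙 (isInner₂ v)
  F-partition v with kind v
  ... | outside Fv Av    rewrite Fv | Av      = refl
  ... | attached Fv Av   rewrite Fv | Av      = refl
  ... | inner₂ Fv Av dv  rewrite Fv | Av | dv = refl
  ... | inner₃ Fv Av dv  rewrite Fv | Av | dv = refl

  F-degree-split : ∀ v → 𝟙 (F v) * d v ≡ hub v * d v + 2 * 𝟙 (isInner₂ v)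
  F-degree-split v with kind v
  ... | outside Fv Av    rewrite Fv | Av      = refl
  ... | attached Fv Av   rewrite Fv | Av      = sym (+-identityʳ _)
  ... | inner₂ Fv Av dv  rewrite Fv | Av | dv = refl
  ... | inner₃ Fv Av dv  rewrite Fv | Av | dv = sym (+-identityʳ _)

  degWeight-split : ∀ v → 𝟙 (F v) * degWeight (d v) ≡ 𝟙 (F v) * d v + 2 * 𝟙 (isIsolated v)
  degWeight-split v with F v
  ... | false = refl
  ... | true with d v
  ...   | zero  = refl
  ...   | suc _ = sym (+-identityʳ _)

  hub-degree-bound : ∀ v → 3 * 𝟙 (isInner₃ v) + 𝟙 (A v) ≤ hub v * d v + 𝟙 (isIsolated v)
  hub-degree-bound v with kind v
  ... | outside Fv Av    rewrite Fv | Av      = z≤n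
  ... | inner₂ Fv Av dv  rewrite Fv | Av | dv = z≤n
  ... | inner₃ Fv Av dv  rewrite Fv | Av | dv = s≤s (s≤s (s≤s z≤n))
  ... | attached Fv Av   rewrite Fv | Av with d v
  ...   | zero  = s≤s z≤n
  ...   | suc _ = s≤s z≤n

  inner₂-hub-neighbours : ∀ {w} → F w ≡ true → A w ≡ false → d w ≡ 2 →
                          2 ≤ sum (λ v → 𝟙 (adj w v) * hub v)
  inner₂-hub-neighbours {w} Fw Aw dw = ≤-trans (≤-reflexive (sym dw)) (sum-mono-≤ neighbour-is-hub)
    where
    neighbour-is-hub : ∀ v → 𝟙 (adj w v ∧ F v) ≤ 𝟙 (adj w v) * hub v
    neighbour-is-hub v with adj w v in wv | kind v
    ... | false | _               = z≤n
    ... | true  | outside Fv _    rewrite Fv           = z≤n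
    ... | true  | attached Fv Av  rewrite Fv | Av      = ≤-refl
    ... | true  | inner₃ Fv Av dv rewrite Fv | Av | dv = ≤-refl
    ... | true  | inner₂ Fv Av dv = ⊥-elim (inner₂-nonadjacent Fw Aw dw Fv Av dv wv)

  inner₂-has-hub-neighbours : ∀ w → 2 * 𝟙 (isInner₂ w) ≤ 𝟙 (isInner₂ w) * sum (λ v → 𝟙 (adj w v) * hub v)
  inner₂-has-hub-neighbours w with kind w
  ... | outside Fw _     rewrite Fw           = z≤n
  ... | attached Fw Aw   rewrite Fw | Aw      = z≤n
  ... | inner₃ Fw Aw dw  rewrite Fw | Aw | dw = z≤n
  ... | inner₂ Fw Aw dw  rewrite Fw | Aw | dw =
    ≤-trans (inner₂-hub-neighbours Fw Aw dw) (≤-reflexive (sym (+-identityʳ _)))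

  inner₂-neighbours≤d : ∀ v → sum (λ w → 𝟙 (adj v w) * 𝟙 (isInner₂ w)) ≤ d v
  inner₂-neighbours≤d v = sum-mono-≤ inner₂⇒F
    where
    inner₂⇒F : ∀ w → 𝟙 (adj v w) * 𝟙 (isInner₂ w) ≤ 𝟙 (adj v w ∧ F w)
    inner₂⇒F w with adj v w
    ... | false = z≤n
    ... | true  = ≤-trans (≤-reflexive (+-identityʳ _)) (≤-trans (m≤n+m _ (hub w)) (≤-reflexive (sym (F-partition w))))

  #A #inner₂ #inner₃ #isolated hubDegrees : ℕ
  #A         = count A
  #inner₂    = count isInner₂
  #inner₃    = count isInner₃
  #isolated  = count isIsolated
  hubDegrees = sum (λ v → hub v * d v)

  count-F : count F ≡ #A + #inner₃ + #inner₂
  count-F = begin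
    count F                             ≡⟨ sum-cong-≗ F-partition ⟩
    sum (λ v → hub v + 𝟙 (isInner₂ v))  ≡⟨ ∑-distrib-+ hub (𝟙 ∘ isInner₂) ⟩
    sum hub + #inner₂                   ≡⟨ cong (_+ #inner₂) (∑-distrib-+ (𝟙 ∘ A) (𝟙 ∘ isInner₃)) ⟩
    #A + #inner₃ + #inner₂              ∎
    where open ≡-Reasoning

  weight-F : weight G F ≡ hubDegrees + 2 * #inner₂ + 2 * #isolated
  weight-F = begin
    weight G F
      ≡⟨ sum-cong-≗ degWeight-split ⟩
    sum (λ v → 𝟙 (F v) * d v + 2 * 𝟙 (isIsolated v))
      ≡⟨ ∑-distrib-+ (λ v → 𝟙 (F v) * d v) (λ v → 2 * 𝟙 (isIsolated v)) ⟩
    sum (λ v → 𝟙 (F v) * d v) + sum (λ v → 2 * 𝟙 (isIsolated v))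
      ≡⟨ cong₂ _+_ (sum-cong-≗ F-degree-split) (sym (*-distribˡ-sum 2 (𝟙 ∘ isIsolated))) ⟩
    sum (λ v → hub v * d v + 2 * 𝟙 (isInner₂ v)) + 2 * #isolated
      ≡⟨ cong (_+ 2 * #isolated) (trans (∑-distrib-+ (λ v → hub v * d v) (λ v → 2 * 𝟙 (isInner₂ v)))
                                        (cong (hubDegrees +_) (sym (*-distribˡ-sum 2 (𝟙 ∘ isInner₂))))) ⟩
    hubDegrees + 2 * #inner₂ + 2 * #isolated ∎
    where open ≡-Reasoning

  forest-inequality : hubDegrees + 2 * #isolated ≤ 2 * (#A + #inner₃)
  forest-inequality = +-cancelʳ-≤ (2 * #inner₂) _ _ (begin
    hubDegrees + 2 * #isolated + 2 * #inner₂  ≡⟨ xy∙z≈xz∙y hubDegrees (2 * #isolated) (2 * #inner₂) ⟩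
    hubDegrees + 2 * #inner₂ + 2 * #isolated  ≡⟨ sym weight-F ⟩
    weight G F                                ≤⟨ acyclic⇒weight≤ G F-acyclic ⟩
    2 * count F                               ≡⟨ cong (2 *_) count-F ⟩
    2 * (#A + #inner₃ + #inner₂)              ≡⟨ *-distribˡ-+ 2 (#A + #inner₃) #inner₂ ⟩
    2 * (#A + #inner₃) + 2 * #inner₂          ∎)
    where open ≤-Reasoning

  degree-inequality : 3 * #inner₃ + #A ≤ hubDegrees + #isolated
  degree-inequality = begin
    3 * #inner₃ + #A                             ≡⟨ cong (_+ #A) (*-distribˡ-sum 3 (𝟙 ∘ isInner₃)) ⟩
    sum (λ v → 3 * 𝟙 (isInner₃ v)) + #A          ≡⟨ sym (∑-distrib-+ (λ v → 3 * 𝟙 (isInner₃ v)) (𝟙 ∘ A)) ⟩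
    sum (λ v → 3 * 𝟙 (isInner₃ v) + 𝟙 (A v))    ≤⟨ sum-mono-≤ hub-degree-bound ⟩
    sum (λ v → hub v * d v + 𝟙 (isIsolated v))  ≡⟨ ∑-distrib-+ (λ v → hub v * d v) (𝟙 ∘ isIsolated) ⟩
    hubDegrees + #isolated                       ∎
    where open ≤-Reasoning

  double-counting : 2 * #inner₂ ≤ hubDegrees
  double-counting = begin
    2 * #inner₂
      ≡⟨ *-distribˡ-sum 2 (𝟙 ∘ isInner₂) ⟩
    sum (λ w → 2 * 𝟙 (isInner₂ w))
      ≤⟨ sum-mono-≤ inner₂-has-hub-neighbours ⟩
    sum (λ w → 𝟙 (isInner₂ w) * sum (λ v → 𝟙 (adj w v) * hub v))
      ≡⟨ sum-cong-≗ (λ w → *-distribˡ-sum (𝟙 (isInner₂ w)) (λ v → 𝟙 (adj w v) * hub v)) ⟩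
    sum (λ w → sum (λ v → 𝟙 (isInner₂ w) * (𝟙 (adj w v) * hub v)))
      ≡⟨ ∑-comm (λ w v → 𝟙 (isInner₂ w) * (𝟙 (adj w v) * hub v)) ⟩
    sum (λ v → sum (λ w → 𝟙 (isInner₂ w) * (𝟙 (adj w v) * hub v)))
      ≡⟨ sum-cong-≗ (λ v → sum-cong-≗ (λ w → edge-term w v)) ⟩
    sum (λ v → sum (λ w → hub v * (𝟙 (adj v w) * 𝟙 (isInner₂ w))))
      ≡⟨ sum-cong-≗ (λ v → sym (*-distribˡ-sum (hub v) (λ w → 𝟙 (adj v w) * 𝟙 (isInner₂ w)))) ⟩
    sum (λ v → hub v * sum (λ w → 𝟙 (adj v w) * 𝟙 (isInner₂ w)))
      ≤⟨ sum-mono-≤ (λ v → *-monoʳ-≤ (hub v) (inner₂-neighbours≤d v)) ⟩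
    hubDegrees ∎
    where
    open ≤-Reasoning
    edge-term : ∀ w v → 𝟙 (isInner₂ w) * (𝟙 (adj w v) * hub v) ≡ hub v * (𝟙 (adj v w) * 𝟙 (isInner₂ w))
    edge-term w v rewrite adj-sym w v = x∙yz≈z∙yx (𝟙 (isInner₂ w)) (𝟙 (adj v w)) (hub v)

lemma6 : ∀ {n : ℕ} (G : Graph n) (S : Subset n) →
         IsReduced G → IsFVS G S →
         ∣ ∁ S ∣ ≤ 4 * ∣ NSet G S ∩ ∁ S ∣
lemma6 G S reduced fvs = begin
  ∣ ∁ S ∣                 ≡⟨ count-lookup (∁ S) ⟩
  count F                 ≡⟨ count-F ⟩
  #A + #inner₃ + #inner₂  ≤⟨ four-attachments-bound #A #inner₃ #inner₂ #isolated hubDegrees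
                               forest-inequality degree-inequality double-counting ⟩
  4 * #A                  ≡⟨ cong (4 *_) (sym (count-lookup (NSet G S ∩ ∁ S))) ⟩
  4 * ∣ NSet G S ∩ ∁ S ∣  ∎
  where
  open Counting G S reduced fvs
  open ≤-Reasoning
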